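{- Let $q=2^k$ with $k\ge1$, let $n=4m+2$ with $m\ge0$, and assume $\theta\in\mathrm{GF}(q^n)$ generates a self-dual normal basis $\{\theta,\theta^q,\dots,\theta^{q^{n-1}}\}$ of $\mathrm{GF}(q^n)$ over $\mathrm{GF}(q)$. Let $\varepsilon=Tr_{q^{2m+1}}(\theta^{q^{2m+1}+1})$. Then $Tr_{q:2}(\varepsilon)=1$.
   Context: For finite fields $\mathrm{GF}(Q^r)\supseteq\mathrm{GF}(Q)$, $Tr_{Q^r:Q}(x)=\sum_{i=0}^{r-1}x^{Q^i}$. $Tr_{q^{2m+1}}$ denotes the trace from $\mathrm{GF}(q^{2m+1})$ to $\mathrm{GF}(q)$ (note $\theta^{q^{2m+1}+1}\in\mathrm{GF}(q^{2m+1})$), and $Tr_{q:2}$ is the trace from $\mathrm{GF}(q)$ to $\mathrm{GF}(2)$. A normal basis $\{\theta,\dots,\theta^{q^{n-1}}\}$ is self-dual if $Tr_{q^n:q}(\theta^{q^i}\theta^{q^j})=[i=j]$ for all $0\le i,j<n$. -}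

module Defs where

import Data.Nat
import Data.Fin
open import Data.Nat using (ℕ; zero; suc)
open import Data.Fin using (Fin; zero; suc; _≟_)
open import Data.Product using (∃; _×_)
open import Relation.Nullary using (¬_; yes; no)
open import Relation.Binary.PropositionalEquality using (_≡_)
open import Algebra.Structures using (IsCommutativeRing)

record Field : Set₁ where
  infixl 6 _+_
  infixl 7 _*_
  field
    Carrier : Set
    _+_ _*_ : Carrier → Carrier → Carrier
    -_      : Carrier → Carrier
    0# 1#   : Carrier
    isCommutativeRing : IsCommutativeRing _≡_ _+_ _*_ -_ 0# 1#
    0≢1     : ¬ (0# ≡ 1#)
    inverse : ∀ x → ¬ (x ≡ 0#) → ∃ λ y → x * y ≡ 1#

module _ (F : Field) where
  open Field F

  pow : Carrier → ℕ → Carrier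
  pow x zero    = 1#
  pow x (suc n) = x * pow x n

  sumFin : (n : ℕ) → (Fin n → Carrier) → Carrier
  sumFin zero    f = 0#
  sumFin (suc n) f = f zero + sumFin n (λ i → f (suc i))

  Tr : (Q r : ℕ) → Carrier → Carrier
  Tr Q r x = sumFin r (λ i → pow x (Data.Nat._^_ Q (Data.Fin.toℕ i)))

  InGF : ℕ → Carrier → Set
  InGF Q c = pow c Q ≡ c

  IsNormalBasis : (Q n : ℕ) → Carrier → Set
  IsNormalBasis Q n θ =
    (∀ (x : Carrier) → ∃ λ (c : Fin n → Carrier) →
        (∀ i → InGF Q (c i)) × (x ≡ sumFin n (λ i → c i * pow θ (Data.Nat._^_ Q (Data.Fin.toℕ i)))))
    × (∀ (c : Fin n → Carrier) → (∀ i → InGF Q (c i)) →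
        sumFin n (λ i → c i * pow θ (Data.Nat._^_ Q (Data.Fin.toℕ i))) ≡ 0# →
        ∀ i → c i ≡ 0#)

  δ : {n : ℕ} → Fin n → Fin n → Carrier
  δ i j with i ≟ j
  ... | yes _ = 1#
  ... | no  _ = 0#

  IsSelfDual : (Q n : ℕ) → Carrier → Set
  IsSelfDual Q n θ =
    ∀ (i j : Fin n) →
      Tr Q n (pow θ (Data.Nat._^_ Q (Data.Fin.toℕ i)) * pow θ (Data.Nat._^_ Q (Data.Fin.toℕ j))) ≡ δ i j

{-# OPTIONS --safe #-}
module Submission where

-- The field has characteristic 2: otherwise negation would be an involution of a
-- set of even size whose only fixed point is 0. Let t = 2m + 1, n = 2t, T = Tr_{q^n:q},
-- h = Tr_{q^t:q} and x̄ = x^(q^t). Self-duality gives T(θ²) = 1, hence θ^(q^n) = θ,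
-- and T(θ)² = Σ_j T(θ θ^(q^j)) = 1, hence T(θ) = 1; for y = h(θ) this says y + ȳ = 1.
-- In y ȳ = Σ_{i,j<t} θ^(q^i) θ^(q^(t+j)) each diagonal term has h-value h(θ^(q^t+1)) = ε,
-- while the off-diagonal terms pair up as z + z̄ with h(z + z̄) = T(z) = 0 by
-- orthogonality; t being odd, h(y ȳ) = ε. But y ȳ = y² + y, so ε = w² + w for
-- w = h(y), and Tr_{q:2}(w² + w) = w^q + w = ȳ + y = 1.

open import Defs
open import Data.Nat as ℕ using (ℕ; zero; suc)
import Data.Nat.Properties as ℕ
open import Data.Fin as Fin using (Fin; toℕ; punchIn)
open import Data.Fin.Properties using (<-cmp; <-irrefl; punchInᵢ≢i; inj⇒≟; toℕ-fromℕ<; toℕ<n)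
open import Data.Fin.Permutation using (permutation)
open import Data.Vec.Functional using (Vector)
open import Data.Product using (∃; _,_)
open import Data.Maybe using (nothing)
open import Function.Base using (_∘_)
open import Function.Bundles using (_⤖_; _↔_; Inverse; Bijection)
open import Function.Properties.Bijection using (⤖⇒↔)
open import Algebra.Bundles using (CommutativeRing)
open import Algebra.Definitions using (Involutive)
open import Relation.Binary.Definitions using (DecidableEquality; tri<; tri≈; tri>)
open import Relation.Binary.PropositionalEquality
  using (_≡_; _≢_; refl; sym; trans; cong; cong₂; subst; module ≡-Reasoning)
open import Relation.Nullary using (Dec; yes; no; ¬_; contradiction)
open import Tactic.RingSolver.Core.AlmostCommutativeRing using (fromCommutativeRing)
import Tactic.RingSolver.NonReflective as RingSolver
open ≡-Reasoning

module _ where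
  open import Data.Nat using (_+_; _*_)
  open import Algebra.Properties.CommutativeMonoid.Sum ℕ.+-0-commutativeMonoid
    using (sum; sum-cong-≗; ∑-distrib-+; sum-permute; sum-remove)

  [_] : {P : Set} → Dec P → ℕ
  [ yes _ ] = 1
  [ no  _ ] = 0

  ¬P⇒[P?]≡0 : {P : Set} (P? : Dec P) → ¬ P → [ P? ] ≡ 0
  ¬P⇒[P?]≡0 (yes p) ¬p = contradiction p ¬p
  ¬P⇒[P?]≡0 (no _)  _  = refl

  [x<y]+[y<x]≡1 : ∀ {N} {x y : Fin N} → x ≢ y → [ x Fin.<? y ] + [ y Fin.<? x ] ≡ 1
  [x<y]+[y<x]≡1 {x = x} {y} x≢y with <-cmp x y
  ... | tri< x<y _ y≮x rewrite ¬P⇒[P?]≡0 (y Fin.<? x) y≮x with x Fin.<? y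
  ...   | yes _  = refl
  ...   | no x≮y = contradiction x<y x≮y
  [x<y]+[y<x]≡1 x≢y | tri≈ _ x≡y _ = contradiction x≡y x≢y
  [x<y]+[y<x]≡1 {x = x} {y} x≢y | tri> x≮y _ y<x rewrite ¬P⇒[P?]≡0 (x Fin.<? y) x≮y with y Fin.<? x
  ...   | yes _  = refl
  ...   | no y≮x = contradiction y<x y≮x

  sum-ones : ∀ n → sum {n} (λ _ → 1) ≡ n
  sum-ones zero    = refl
  sum-ones (suc n) = cong suc (sum-ones n)

  -- Counting ascents x < g x and descents g x < x: they are equinumerous (g permutes
  -- them) and together cover every point except the fixed point.
  involution-with-one-fixedPoint⇒odd :
    ∀ {N} (g : Fin N → Fin N) → Involutive _≡_ g → (z : Fin N) → g z ≡ z →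
    (∀ x → g x ≡ x → x ≡ z) → ∃ λ a → N ≡ suc (2 * a)
  involution-with-one-fixedPoint⇒odd {suc n} g g-inv z gz≡z fixed⇒z = A , cong suc n≡2A
    where
    ascent descent pairs : Fin (suc n) → ℕ
    ascent  x = [ x Fin.<? g x ]
    descent x = [ g x Fin.<? x ]
    pairs   x = ascent x + descent x

    A : ℕ
    A = sum ascent

    descents≡ascents : sum descent ≡ A
    descents≡ascents = begin
      sum descent        ≡⟨ sum-permute descent (permutation g g g-inv g-inv) ⟩
      sum (descent ∘ g)  ≡⟨ sum-cong-≗ (λ x → cong (λ u → [ u Fin.<? g x ]) (g-inv x)) ⟩
      A                  ∎

    pairs-off-z : ∀ j → pairs (punchIn z j) ≡ 1
    pairs-off-z j = [x<y]+[y<x]≡1 λ x≡gx → punchInᵢ≢i z j (fixed⇒z _ (sym x≡gx))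

    pairs-at-z : pairs z ≡ 0
    pairs-at-z rewrite gz≡z | ¬P⇒[P?]≡0 (z Fin.<? z) (<-irrefl refl) = refl

    n≡2A : n ≡ 2 * A
    n≡2A = begin
      n                                    ≡⟨ sum-ones n ⟨
      sum {n} (λ _ → 1)                    ≡⟨ sum-cong-≗ (λ j → sym (pairs-off-z j)) ⟩
      sum (pairs ∘ punchIn z)              ≡⟨ cong (_+ sum (pairs ∘ punchIn z)) pairs-at-z ⟨
      pairs z + sum (pairs ∘ punchIn z)    ≡⟨ sum-remove pairs ⟨
      sum pairs                            ≡⟨ ∑-distrib-+ ascent descent ⟩
      A + sum descent                      ≡⟨ cong (A +_) (trans descents≡ascents (sym (ℕ.+-identityʳ A))) ⟩
      2 * A                                ∎

  finite-involution-with-one-fixedPoint⇒odd :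
    ∀ {A : Set} {N} → A ↔ Fin N → (g : A → A) → Involutive _≡_ g → (z : A) → g z ≡ z →
    (∀ x → g x ≡ x → x ≡ z) → ∃ λ a → N ≡ suc (2 * a)
  finite-involution-with-one-fixedPoint⇒odd A↔Fin g g-inv z gz≡z fixed⇒z =
    involution-with-one-fixedPoint⇒odd g′ g′-inv (to z) g′[to-z]≡to-z g′-fixed⇒to-z
    where
    open Inverse A↔Fin using (to; from; strictlyInverseˡ; strictlyInverseʳ)

    g′ : Fin _ → Fin _
    g′ = to ∘ g ∘ from

    g′-inv : Involutive _≡_ g′
    g′-inv v = begin
      to (g (from (to (g (from v)))))  ≡⟨ cong (to ∘ g) (strictlyInverseʳ _) ⟩
      to (g (g (from v)))              ≡⟨ cong to (g-inv _) ⟩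
      to (from v)                      ≡⟨ strictlyInverseˡ v ⟩
      v                                ∎

    g′[to-z]≡to-z : g′ (to z) ≡ to z
    g′[to-z]≡to-z = trans (cong (to ∘ g) (strictlyInverseʳ z)) (cong to gz≡z)

    g′-fixed⇒to-z : ∀ v → g′ v ≡ v → v ≡ to z
    g′-fixed⇒to-z v g′v≡v = trans (sym (strictlyInverseˡ v)) (cong to (fixed⇒z (from v) g-fixes))
      where
      g-fixes : g (from v) ≡ from v
      g-fixes = trans (sym (strictlyInverseʳ _)) (cong from g′v≡v)

commutativeRing : Field → CommutativeRing _ _
commutativeRing F = record { isCommutativeRing = Field.isCommutativeRing F }

module _ (F : Field) where
  open CommutativeRing (commutativeRing F)
    using ( Carrier; _+_; _*_; -_; 0#; 1#; +-assoc; +-comm; +-identityˡ; +-identityʳ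
          ; *-assoc; *-comm; *-identityˡ; *-identityʳ; distribˡ; distribʳ; zeroˡ; zeroʳ
          ; -‿inverseʳ; ring; commutativeSemiring; semiring; +-monoid; *-monoid)
  open import Algebra.Properties.Ring ring
    using (+-cancelˡ; +-cancelʳ; -‿involutive; -0#≈0#; +-inverseʳ-unique)
  open import Algebra.Properties.CommutativeSemiring.Exp commutativeSemiring
    using (_^_; ^-homo-*; ^-assocʳ; ^-distrib-*)
  open import Algebra.Properties.Semiring.Sum semiring
    using (sum; sum-cong-≗; ∑-distrib-+; ∑-comm; *-distribˡ-sum; *-distribʳ-sum; sum-replicate-zero)
  open import Algebra.Properties.Monoid.Mult +-monoid using (_×_; ×-assocˡ)
  import Algebra.Properties.Monoid.Mult *-monoid as Power
  open RingSolver (fromCommutativeRing (commutativeRing F) (λ _ → nothing))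
    using (solve; _⊜_; _⊕_; _⊗_)

  pow≡^ : ∀ x n → pow F x n ≡ x ^ n
  pow≡^ x zero    = refl
  pow≡^ x (suc n) = cong (x *_) (pow≡^ x n)

  sumFin≡sum : ∀ n f → sumFin F n f ≡ sum f
  sumFin≡sum zero    f = refl
  sumFin≡sum (suc n) f = cong (f Fin.zero +_) (sumFin≡sum n (f ∘ Fin.suc))

  ^-swap : ∀ x a b → (x ^ a) ^ b ≡ (x ^ b) ^ a
  ^-swap x a b = trans (^-assocʳ x a b) (trans (cong (x ^_) (ℕ.*-comm a b)) (sym (^-assocʳ x b a)))

  conjugates : (Q r : ℕ) → Carrier → Vector Carrier r
  conjugates Q r x i = x ^ (Q ℕ.^ toℕ i)

  tr : ℕ → ℕ → Carrier → Carrier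
  tr Q r x = sum (conjugates Q r x)

  Tr≡tr : ∀ Q r x → Tr F Q r x ≡ tr Q r x
  Tr≡tr Q r x = trans (sumFin≡sum r _) (sum-cong-≗ {r} λ i → pow≡^ x (Q ℕ.^ toℕ i))

  selfDual⇒tr≡δ : ∀ {Q n θ} → IsSelfDual F Q n θ →
    ∀ i j → tr Q n (conjugates Q n θ i * conjugates Q n θ j) ≡ δ F i j
  selfDual⇒tr≡δ {Q} {n} {θ} self-dual i j = begin
    tr Q n (conjugates Q n θ i * conjugates Q n θ j)
      ≡⟨ Tr≡tr Q n _ ⟨
    Tr F Q n (conjugates Q n θ i * conjugates Q n θ j)
      ≡⟨ cong (Tr F Q n) (cong₂ _*_ (pow≡^ θ (Q ℕ.^ toℕ i)) (pow≡^ θ (Q ℕ.^ toℕ j))) ⟨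
    Tr F Q n (pow F θ (Q ℕ.^ toℕ i) * pow F θ (Q ℕ.^ toℕ j))
      ≡⟨ self-dual i j ⟩
    δ F i j
      ∎

  δ-≢ : ∀ {n} {i j : Fin n} → i ≢ j → δ F i j ≡ 0#
  δ-≢ {i = i} {j} i≢j with i Fin.≟ j
  ... | yes i≡j = contradiction i≡j i≢j
  ... | no  _   = refl

  δ-suc : ∀ {n} (i j : Fin n) → δ F (Fin.suc i) (Fin.suc j) ≡ δ F i j
  δ-suc i j with i Fin.≟ j
  ... | yes _ = refl
  ... | no  _ = refl

  ∑-δ≡1 : ∀ {n} (i : Fin n) → sum (δ F i) ≡ 1#
  ∑-δ≡1 {suc n} Fin.zero    = trans (cong (1# +_) (sum-replicate-zero n)) (+-identityʳ 1#)
  ∑-δ≡1 {suc n} (Fin.suc i) = begin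
    0# + sum (δ F (Fin.suc i) ∘ Fin.suc)  ≡⟨ +-identityˡ _ ⟩
    sum (δ F (Fin.suc i) ∘ Fin.suc)       ≡⟨ sum-cong-≗ (δ-suc i) ⟩
    sum (δ F i)                           ≡⟨ ∑-δ≡1 i ⟩
    1#                                    ∎

  nonzero*x≡0⇒x≡0 : ∀ {a x} → a ≢ 0# → a * x ≡ 0# → x ≡ 0#
  nonzero*x≡0⇒x≡0 {a} {x} a≢0 ax≡0 with Field.inverse F a a≢0
  ... | b , ab≡1 = begin
    x            ≡⟨ *-identityˡ x ⟨
    1# * x       ≡⟨ cong (_* x) (trans (sym ab≡1) (*-comm a b)) ⟩
    b * a * x    ≡⟨ *-assoc b a x ⟩
    b * (a * x)  ≡⟨ cong (b *_) ax≡0 ⟩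
    b * 0#       ≡⟨ zeroʳ b ⟩
    0#           ∎

  x*x≡0⇒x≡0 : DecidableEquality Carrier → ∀ {x} → x * x ≡ 0# → x ≡ 0#
  x*x≡0⇒x≡0 _≟_ {x} x*x≡0 with x ≟ 0#
  ... | yes x≡0 = x≡0
  ... | no  x≢0 = nonzero*x≡0⇒x≡0 x≢0 x*x≡0

  evenOrder⇒1+1≡0 : ∀ {b} → Carrier ⤖ Fin (2 ℕ.* b) → 1# + 1# ≡ 0#
  evenOrder⇒1+1≡0 {b} bij with inj⇒≟ (Bijection.injection bij) (1# + 1#) 0#
  ... | yes 1+1≡0 = 1+1≡0
  ... | no  1+1≢0 with finite-involution-with-one-fixedPoint⇒odd (⤖⇒↔ bij) -_ -‿involutive 0# -0#≈0# -x≡x⇒x≡0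
    where
    -x≡x⇒x≡0 : ∀ x → - x ≡ x → x ≡ 0#
    -x≡x⇒x≡0 x -x≡x = nonzero*x≡0⇒x≡0 1+1≢0 (begin
      (1# + 1#) * x    ≡⟨ distribʳ x 1# 1# ⟩
      1# * x + 1# * x  ≡⟨ cong₂ _+_ (*-identityˡ x) (trans (*-identityˡ x) (sym -x≡x)) ⟩
      x + - x          ≡⟨ -‿inverseʳ x ⟩
      0#               ∎)
  ... | a , 2b≡1+2a = contradiction 2b≡1+2a (ℕ.even≢odd b a)

  x^2≡x*x : ∀ x → x ^ 2 ≡ x * x
  x^2≡x*x x = cong (x *_) (*-identityʳ x)

  AdditiveExponent : ℕ → Set
  AdditiveExponent e = ∀ x y → (x + y) ^ e ≡ x ^ e + y ^ e

  additive-1 : AdditiveExponent 1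
  additive-1 x y = trans (*-identityʳ (x + y)) (sym (cong₂ _+_ (*-identityʳ x) (*-identityʳ y)))

  additive-* : ∀ d e → AdditiveExponent d → AdditiveExponent e → AdditiveExponent (d ℕ.* e)
  additive-* d e d-add e-add x y = begin
    (x + y) ^ (d ℕ.* e)            ≡⟨ ^-assocʳ (x + y) d e ⟨
    ((x + y) ^ d) ^ e              ≡⟨ cong (_^ e) (d-add x y) ⟩
    (x ^ d + y ^ d) ^ e            ≡⟨ e-add (x ^ d) (y ^ d) ⟩
    (x ^ d) ^ e + (y ^ d) ^ e      ≡⟨ cong₂ _+_ (^-assocʳ x d e) (^-assocʳ y d e) ⟩
    x ^ (d ℕ.* e) + y ^ (d ℕ.* e)  ∎

  additive-^ : ∀ e → AdditiveExponent e → ∀ j → AdditiveExponent (e ℕ.^ j)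
  additive-^ e e-add zero    = additive-1
  additive-^ e e-add (suc j) = additive-* e (e ℕ.^ j) e-add (additive-^ e e-add j)

  module _ (e : ℕ) (e-add : AdditiveExponent e) where

    0^e≡0 : 0# ^ e ≡ 0#
    0^e≡0 = sym (+-cancelˡ (0# ^ e) 0# (0# ^ e) (begin
      0# ^ e + 0#      ≡⟨ +-identityʳ _ ⟩
      0# ^ e           ≡⟨ cong (_^ e) (+-identityʳ 0#) ⟨
      (0# + 0#) ^ e    ≡⟨ e-add 0# 0# ⟩
      0# ^ e + 0# ^ e  ∎))

    ^-distrib-sum : ∀ {n} (f : Vector Carrier n) → sum f ^ e ≡ sum (λ i → f i ^ e)
    ^-distrib-sum {zero}  f = 0^e≡0
    ^-distrib-sum {suc n} f = trans (e-add _ _) (cong (f Fin.zero ^ e +_) (^-distrib-sum (f ∘ Fin.suc)))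

  module Trace (Q : ℕ) (Q-add : AdditiveExponent Q) where

    Q^j-add : ∀ j → AdditiveExponent (Q ℕ.^ j)
    Q^j-add = additive-^ Q Q-add

    fixed-^Q^j : ∀ {c} → c ^ Q ≡ c → ∀ j → c ^ (Q ℕ.^ j) ≡ c
    fixed-^Q^j {c} c^Q≡c zero    = *-identityʳ c
    fixed-^Q^j {c} c^Q≡c (suc j) = begin
      c ^ (Q ℕ.* Q ℕ.^ j)  ≡⟨ ^-assocʳ c Q (Q ℕ.^ j) ⟨
      (c ^ Q) ^ (Q ℕ.^ j)  ≡⟨ cong (_^ (Q ℕ.^ j)) c^Q≡c ⟩
      c ^ (Q ℕ.^ j)        ≡⟨ fixed-^Q^j c^Q≡c j ⟩
      c                    ∎

    tr-0 : ∀ r → tr Q r 0# ≡ 0#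
    tr-0 r = trans (sum-cong-≗ {r} λ i → 0^e≡0 (Q ℕ.^ toℕ i) (Q^j-add (toℕ i))) (sum-replicate-zero r)

    tr-homo-+ : ∀ r x y → tr Q r (x + y) ≡ tr Q r x + tr Q r y
    tr-homo-+ r x y = trans (sum-cong-≗ {r} λ i → Q^j-add (toℕ i) x y)
                            (∑-distrib-+ (conjugates Q r x) (conjugates Q r y))

    tr-sum : ∀ r {n} (f : Vector Carrier n) → tr Q r (sum f) ≡ sum (λ j → tr Q r (f j))
    tr-sum r f = trans (sum-cong-≗ {r} λ i → ^-distrib-sum (Q ℕ.^ toℕ i) (Q^j-add (toℕ i)) f)
                       (∑-comm λ i j → conjugates Q r (f j) i)

    tr-^ : ∀ e → AdditiveExponent e → ∀ r x → tr Q r (x ^ e) ≡ tr Q r x ^ e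
    tr-^ e e-add r x = trans (sum-cong-≗ {r} λ i → ^-swap x e (Q ℕ.^ toℕ i))
                             (sym (^-distrib-sum e e-add (conjugates Q r x)))

    tr-scalar : ∀ {c} → c ^ Q ≡ c → ∀ r x → tr Q r (c * x) ≡ c * tr Q r x
    tr-scalar {c} c^Q≡c r x = begin
      tr Q r (c * x)                          ≡⟨ sum-cong-≗ {r} (λ i → ^-distrib-* c x (Q ℕ.^ toℕ i)) ⟩
      sum (λ i → c ^ (Q ℕ.^ toℕ i) * conjugates Q r x i)
        ≡⟨ sum-cong-≗ {r} (λ i → cong (_* _) (fixed-^Q^j c^Q≡c (toℕ i))) ⟩
      sum (λ i → c * conjugates Q r x i)      ≡⟨ *-distribˡ-sum c (conjugates Q r x) ⟨
      c * tr Q r x                            ∎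

    tr-suc : ∀ r x → tr Q (suc r) x ≡ x + tr Q r (x ^ Q)
    tr-suc r x = cong₂ _+_ (*-identityʳ x) (sum-cong-≗ {r} λ i → sym (^-assocʳ x Q (Q ℕ.^ toℕ i)))

    tr-split : ∀ a b x → tr Q (a ℕ.+ b) x ≡ tr Q a x + tr Q b (x ^ (Q ℕ.^ a))
    tr-split zero    b x = begin
      tr Q b x             ≡⟨ cong (tr Q b) (*-identityʳ x) ⟨
      tr Q b (x ^ 1)       ≡⟨ +-identityˡ _ ⟨
      0# + tr Q b (x ^ 1)  ∎
    tr-split (suc a) b x = begin
      tr Q (suc a ℕ.+ b) x                                 ≡⟨ tr-suc (a ℕ.+ b) x ⟩
      x + tr Q (a ℕ.+ b) (x ^ Q)                           ≡⟨ cong (x +_) (tr-split a b (x ^ Q)) ⟩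
      x + (tr Q a (x ^ Q) + tr Q b ((x ^ Q) ^ (Q ℕ.^ a)))  ≡⟨ +-assoc x _ _ ⟨
      x + tr Q a (x ^ Q) + tr Q b ((x ^ Q) ^ (Q ℕ.^ a))
        ≡⟨ cong₂ _+_ (tr-suc a x) (cong (tr Q b) (sym (^-assocʳ x Q (Q ℕ.^ a)))) ⟨
      tr Q (suc a) x + tr Q b (x ^ (Q ℕ.^ suc a))          ∎

    tr-snoc : ∀ r x → tr Q (suc r) x ≡ tr Q r x + x ^ (Q ℕ.^ r)
    tr-snoc r x = begin
      tr Q (suc r) x                     ≡⟨ cong (λ s → tr Q s x) (ℕ.+-comm 1 r) ⟩
      tr Q (r ℕ.+ 1) x                   ≡⟨ tr-split r 1 x ⟩
      tr Q r x + tr Q 1 (x ^ (Q ℕ.^ r))  ≡⟨ cong (tr Q r x +_) (trans (+-identityʳ _) (*-identityʳ _)) ⟩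
      tr Q r x + x ^ (Q ℕ.^ r)           ∎

    tr^Q+x≡x^Q^r+tr : ∀ r x → tr Q r x ^ Q + x ≡ x ^ (Q ℕ.^ r) + tr Q r x
    tr^Q+x≡x^Q^r+tr r x = begin
      tr Q r x ^ Q + x          ≡⟨ +-comm _ x ⟩
      x + tr Q r x ^ Q          ≡⟨ cong (x +_) (tr-^ Q Q-add r x) ⟨
      x + tr Q r (x ^ Q)        ≡⟨ tr-suc r x ⟨
      tr Q (suc r) x            ≡⟨ tr-snoc r x ⟩
      tr Q r x + x ^ (Q ℕ.^ r)  ≡⟨ +-comm _ _ ⟩
      x ^ (Q ℕ.^ r) + tr Q r x  ∎

    tr-fixed⇒fixed : ∀ r x → tr Q r x ^ Q ≡ tr Q r x → x ^ (Q ℕ.^ r) ≡ x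
    tr-fixed⇒fixed r x T^Q≡T = +-cancelʳ (tr Q r x) _ _ (begin
      x ^ (Q ℕ.^ r) + tr Q r x  ≡⟨ tr^Q+x≡x^Q^r+tr r x ⟨
      tr Q r x ^ Q + x          ≡⟨ cong (_+ x) T^Q≡T ⟩
      tr Q r x + x              ≡⟨ +-comm _ x ⟩
      x + tr Q r x              ∎)

    fixed⇒tr-fixed : ∀ r x → x ^ (Q ℕ.^ r) ≡ x → tr Q r x ^ Q ≡ tr Q r x
    fixed⇒tr-fixed r x x^Q^r≡x = +-cancelʳ x _ _ (begin
      tr Q r x ^ Q + x          ≡⟨ tr^Q+x≡x^Q^r+tr r x ⟩
      x ^ (Q ℕ.^ r) + tr Q r x  ≡⟨ cong (_+ tr Q r x) x^Q^r≡x ⟩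
      x + tr Q r x              ≡⟨ +-comm x _ ⟩
      tr Q r x + x              ∎)

    tr-^Q^j-invariant : ∀ r x → x ^ (Q ℕ.^ r) ≡ x → ∀ j → tr Q r (x ^ (Q ℕ.^ j)) ≡ tr Q r x
    tr-^Q^j-invariant r x x^Q^r≡x j =
      trans (tr-^ (Q ℕ.^ j) (Q^j-add j) r x) (fixed-^Q^j (fixed⇒tr-fixed r x x^Q^r≡x) j)

  module _ (1+1≡0 : 1# + 1# ≡ 0#) where

    x+x≡0 : ∀ x → x + x ≡ 0#
    x+x≡0 x = begin
      x + x            ≡⟨ cong₂ _+_ (*-identityˡ x) (*-identityˡ x) ⟨
      1# * x + 1# * x  ≡⟨ distribʳ x 1# 1# ⟨
      (1# + 1#) * x    ≡⟨ cong (_* x) 1+1≡0 ⟩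
      0# * x           ≡⟨ zeroˡ x ⟩
      0#               ∎

    x+y≡0⇒x≡y : ∀ {x y} → x + y ≡ 0# → x ≡ y
    x+y≡0⇒x≡y {x} {y} x+y≡0 =
      trans (+-inverseʳ-unique x x (x+x≡0 x)) (sym (+-inverseʳ-unique x y x+y≡0))

    even×x≡0 : ∀ m x → (2 ℕ.* m) × x ≡ 0#
    even×x≡0 m x = begin
      (2 ℕ.* m) × x        ≡⟨ ×-assocˡ x 2 m ⟨
      m × x + (m × x + 0#) ≡⟨ cong (m × x +_) (+-identityʳ (m × x)) ⟩
      m × x + m × x        ≡⟨ x+x≡0 (m × x) ⟩
      0#                   ∎

    additive-2 : AdditiveExponent 2
    additive-2 x y = begin
      (x + y) ^ 2                      ≡⟨ x^2≡x*x (x + y) ⟩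
      (x + y) * (x + y)
        ≡⟨ solve 2 (λ x y → ((x ⊕ y) ⊗ (x ⊕ y)) ⊜ (x ⊗ x ⊕ y ⊗ y ⊕ (x ⊗ y ⊕ x ⊗ y))) refl x y ⟩
      x * x + y * y + (x * y + x * y)  ≡⟨ cong (x * x + y * y +_) (x+x≡0 (x * y)) ⟩
      x * x + y * y + 0#               ≡⟨ +-identityʳ _ ⟩
      x * x + y * y                    ≡⟨ cong₂ _+_ (x^2≡x*x x) (x^2≡x*x y) ⟨
      x ^ 2 + y ^ 2                    ∎

    square-injective : DecidableEquality Carrier → ∀ {x y} → x * x ≡ y * y → x ≡ y
    square-injective _≟_ {x} {y} x*x≡y*y = x+y≡0⇒x≡y (x*x≡0⇒x≡0 _≟_ (begin
      (x + y) * (x + y)  ≡⟨ x^2≡x*x (x + y) ⟨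
      (x + y) ^ 2        ≡⟨ additive-2 x y ⟩
      x ^ 2 + y ^ 2      ≡⟨ cong₂ _+_ (x^2≡x*x x) (x^2≡x*x y) ⟩
      x * x + y * y      ≡⟨ cong (_+ y * y) x*x≡y*y ⟩
      y * y + y * y      ≡⟨ x+x≡0 (y * y) ⟩
      0#                 ∎))

    tr^Q+tr : ∀ Q → AdditiveExponent Q → ∀ r x → tr Q r x ^ Q + tr Q r x ≡ x ^ (Q ℕ.^ r) + x
    tr^Q+tr Q Q-add r x = x+y≡0⇒x≡y (begin
      (T ^ Q + T) + (x ^ (Q ℕ.^ r) + x)
        ≡⟨ solve 4 (λ a b c d → ((a ⊕ b) ⊕ (c ⊕ d)) ⊜ ((a ⊕ d) ⊕ (c ⊕ b))) refl (T ^ Q) T (x ^ (Q ℕ.^ r)) x ⟩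
      (T ^ Q + x) + (x ^ (Q ℕ.^ r) + T)
        ≡⟨ cong (_+ (x ^ (Q ℕ.^ r) + T)) (Trace.tr^Q+x≡x^Q^r+tr Q Q-add r x) ⟩
      (x ^ (Q ℕ.^ r) + T) + (x ^ (Q ℕ.^ r) + T)  ≡⟨ x+x≡0 _ ⟩
      0#                                         ∎)
      where
      T : Carrier
      T = tr Q r x

    tr-telescope : ∀ Q → AdditiveExponent Q → ∀ r x → tr Q r (x ^ Q + x) ≡ x ^ (Q ℕ.^ r) + x
    tr-telescope Q Q-add r x = begin
      tr Q r (x ^ Q + x)         ≡⟨ tr-homo-+ r (x ^ Q) x ⟩
      tr Q r (x ^ Q) + tr Q r x  ≡⟨ cong (_+ tr Q r x) (tr-^ Q Q-add r x) ⟩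
      tr Q r x ^ Q + tr Q r x    ≡⟨ tr^Q+tr Q Q-add r x ⟩
      x ^ (Q ℕ.^ r) + x          ∎
      where open Trace Q Q-add using (tr-homo-+; tr-^)

    module SelfDualNormalBasis (_≟_ : DecidableEquality Carrier) (k m : ℕ) (θ : Carrier)
      (isSelfDual : IsSelfDual F (2 ℕ.^ k) (suc (2 ℕ.* m) ℕ.+ suc (2 ℕ.* m)) θ) where

      q t n : ℕ
      q = 2 ℕ.^ k
      t = suc (2 ℕ.* m)
      n = t ℕ.+ t

      q-add : AdditiveExponent q
      q-add = additive-^ 2 additive-2 k

      open Trace q q-add

      self-dual : ∀ i j → tr q n (conjugates q n θ i * conjugates q n θ j) ≡ δ F i j
      self-dual = selfDual⇒tr≡δ isSelfDual

      infixr 8 _^q^_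
      _^q^_ : Carrier → ℕ → Carrier
      x ^q^ j = x ^ (q ℕ.^ j)

      T : Carrier → Carrier
      T = tr q n

      ^q^-assoc : ∀ x i j → (x ^q^ i) ^q^ j ≡ x ^q^ (i ℕ.+ j)
      ^q^-assoc x i j = trans (^-assocʳ x (q ℕ.^ i) (q ℕ.^ j)) (cong (x ^_) (sym (ℕ.^-distribˡ-+-* q i j)))

      θ^q^0≡θ : θ ^q^ 0 ≡ θ
      θ^q^0≡θ = *-identityʳ θ

      orthogonal : ∀ {b c} → b ℕ.< n → c ℕ.< n → b ≢ c → T (θ ^q^ b * θ ^q^ c) ≡ 0#
      orthogonal {b} {c} b<n c<n b≢c = begin
        T (θ ^q^ b * θ ^q^ c)
          ≡⟨ cong₂ (λ u v → T (θ ^q^ u * θ ^q^ v)) (toℕ-fromℕ< b<n) (toℕ-fromℕ< c<n) ⟨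
        T (conjugates q n θ i * conjugates q n θ j)  ≡⟨ self-dual i j ⟩
        δ F i j                                      ≡⟨ δ-≢ i≢j ⟩
        0#                                           ∎
        where
        i j : Fin n
        i = Fin.fromℕ< b<n
        j = Fin.fromℕ< c<n

        i≢j : i ≢ j
        i≢j i≡j = b≢c (trans (sym (toℕ-fromℕ< b<n)) (trans (cong toℕ i≡j) (toℕ-fromℕ< c<n)))

      θ^q^n≡θ : θ ^q^ n ≡ θ
      θ^q^n≡θ = square-injective _≟_ (begin
        θ ^q^ n * θ ^q^ n       ≡⟨ ^-distrib-* θ θ (q ℕ.^ n) ⟨
        (θ * θ) ^q^ n           ≡⟨ tr-fixed⇒fixed n (θ * θ) T[θθ]^q≡T[θθ] ⟩
        θ * θ                   ∎)
        where
        T[θθ]≡1 : T (θ * θ) ≡ 1#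
        T[θθ]≡1 = trans (cong T (sym (cong₂ _*_ θ^q^0≡θ θ^q^0≡θ))) (self-dual Fin.zero Fin.zero)
        T[θθ]^q≡T[θθ] : T (θ * θ) ^ q ≡ T (θ * θ)
        T[θθ]^q≡T[θθ] rewrite T[θθ]≡1 = Power.×-idem (*-identityˡ 1#) q {{ℕ.m^n≢0 2 k}}

      Tθ≡1 : T θ ≡ 1#
      Tθ≡1 = square-injective _≟_ (begin
        T θ * T θ                                ≡⟨ tr-scalar (fixed⇒tr-fixed n θ θ^q^n≡θ) n θ ⟨
        T (T θ * θ)                              ≡⟨ cong T (*-comm (T θ) θ) ⟩
        T (θ * T θ)                              ≡⟨ cong T (*-distribˡ-sum θ (conjugates q n θ)) ⟩
        T (sum (λ j → θ * conjugates q n θ j))   ≡⟨ tr-sum n (λ j → θ * conjugates q n θ j) ⟩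
        sum (λ j → T (θ * conjugates q n θ j))   ≡⟨ sum-cong-≗ {n} T[θ*θ^q^j]≡δ ⟩
        sum {n} (δ F Fin.zero)                   ≡⟨ ∑-δ≡1 {n} Fin.zero ⟩
        1#                                       ≡⟨ *-identityˡ 1# ⟨
        1# * 1#                                  ∎)
        where
        T[θ*θ^q^j]≡δ : ∀ j → T (θ * conjugates q n θ j) ≡ δ F Fin.zero j
        T[θ*θ^q^j]≡δ j = trans (cong (λ u → T (u * conjugates q n θ j)) (sym θ^q^0≡θ)) (self-dual Fin.zero j)

      y : Carrier
      y = tr q t θ

      y+y^q^t≡1 : y + y ^q^ t ≡ 1#
      y+y^q^t≡1 = begin
        y + y ^q^ t             ≡⟨ cong (y +_) (tr-^ (q ℕ.^ t) (Q^j-add t) t θ) ⟨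
        y + tr q t (θ ^q^ t)    ≡⟨ tr-split t t θ ⟨
        T θ                     ≡⟨ Tθ≡1 ⟩
        1#                      ∎

      N ε : Carrier
      N = θ ^ (q ℕ.^ t ℕ.+ 1)
      ε = tr q t N

      N≡θ*θ^q^t : N ≡ θ * θ ^q^ t
      N≡θ*θ^q^t = trans (^-homo-* θ (q ℕ.^ t) 1) (trans (cong (θ ^q^ t *_) θ^q^0≡θ) (*-comm _ θ))

      N^q^t≡N : N ^q^ t ≡ N
      N^q^t≡N = begin
        N ^q^ t                         ≡⟨ cong (_^q^ t) N≡θ*θ^q^t ⟩
        (θ * θ ^q^ t) ^q^ t             ≡⟨ ^-distrib-* θ (θ ^q^ t) (q ℕ.^ t) ⟩
        θ ^q^ t * (θ ^q^ t) ^q^ t       ≡⟨ cong (θ ^q^ t *_) (trans (^q^-assoc θ t t) θ^q^n≡θ) ⟩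
        θ ^q^ t * θ                     ≡⟨ *-comm _ θ ⟩
        θ * θ ^q^ t                     ≡⟨ N≡θ*θ^q^t ⟨
        N                               ∎

      tr-diagonal : ∀ r → tr q t (θ ^q^ r * (θ ^q^ r) ^q^ t) ≡ ε
      tr-diagonal r = begin
        tr q t (θ ^q^ r * (θ ^q^ r) ^q^ t)  ≡⟨ cong (λ u → tr q t (θ ^q^ r * u)) (^-swap θ (q ℕ.^ r) (q ℕ.^ t)) ⟩
        tr q t (θ ^q^ r * (θ ^q^ t) ^q^ r)  ≡⟨ cong (tr q t) (^-distrib-* θ (θ ^q^ t) (q ℕ.^ r)) ⟨
        tr q t ((θ * θ ^q^ t) ^q^ r)        ≡⟨ cong (λ u → tr q t (u ^q^ r)) N≡θ*θ^q^t ⟨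
        tr q t (N ^q^ r)                    ≡⟨ tr-^Q^j-invariant t N N^q^t≡N r ⟩
        ε                                   ∎

      conjugate^q^n : ∀ r → (θ ^q^ r) ^q^ n ≡ θ ^q^ r
      conjugate^q^n r = trans (^-swap θ (q ℕ.^ r) (q ℕ.^ n)) (cong (_^q^ r) θ^q^n≡θ)

      tr-cross-term : ∀ {r} → r ℕ.< t →
        tr q t (tr q r θ * (θ ^q^ r) ^q^ t + (tr q r θ) ^q^ t * θ ^q^ r) ≡ 0#
      tr-cross-term {r} r<t = begin
        tr q t (z + a ^q^ t * b)                 ≡⟨ cong (λ u → tr q t (z + u)) z^q^t≡ ⟨
        tr q t (z + z ^q^ t)                     ≡⟨ tr-homo-+ t z (z ^q^ t) ⟩
        tr q t z + tr q t (z ^q^ t)              ≡⟨ tr-split t t z ⟨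
        T z                                      ≡⟨ cong T (*-distribʳ-sum (b ^q^ t) (conjugates q r θ)) ⟩
        T (sum (λ j → conjugates q r θ j * b ^q^ t))  ≡⟨ tr-sum n (λ j → conjugates q r θ j * b ^q^ t) ⟩
        sum (λ j → T (conjugates q r θ j * b ^q^ t))  ≡⟨ sum-cong-≗ {r} orthogonal-terms ⟩
        sum {r} (λ _ → 0#)                       ≡⟨ sum-replicate-zero r ⟩
        0#                                       ∎
        where
        a b z : Carrier
        a = tr q r θ
        b = θ ^q^ r
        z = a * b ^q^ t

        z^q^t≡ : z ^q^ t ≡ a ^q^ t * b
        z^q^t≡ = trans (^-distrib-* a (b ^q^ t) (q ℕ.^ t))
                       (cong (a ^q^ t *_) (trans (^q^-assoc b t t) (conjugate^q^n r)))

        orthogonal-terms : ∀ j → T (conjugates q r θ j * b ^q^ t) ≡ 0#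
        orthogonal-terms j = trans (cong (λ u → T (conjugates q r θ j * u)) (^q^-assoc θ r t))
          (orthogonal j<n r+t<n (ℕ.<⇒≢ (ℕ.<-≤-trans j<r (ℕ.m≤m+n r t))))
          where
          j<r : toℕ j ℕ.< r
          j<r = toℕ<n j
          j<n : toℕ j ℕ.< n
          j<n = ℕ.<-≤-trans (ℕ.<-trans j<r r<t) (ℕ.m≤m+n t t)
          r+t<n : r ℕ.+ t ℕ.< n
          r+t<n = ℕ.+-monoˡ-< t r<t

      tr-partial-norm : ∀ r → r ℕ.≤ t → tr q t (tr q r θ * (tr q r θ) ^q^ t) ≡ r × ε
      tr-partial-norm zero    _     = trans (cong (tr q t) (zeroˡ _)) (tr-0 t)
      tr-partial-norm (suc r) 1+r≤t = begin
        tr q t (tr q (suc r) θ * (tr q (suc r) θ) ^q^ t)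
          ≡⟨ cong (tr q t) (cong₂ _*_ (tr-snoc r θ) (trans (cong (_^q^ t) (tr-snoc r θ)) (Q^j-add t a b))) ⟩
        tr q t ((a + b) * (a ^q^ t + b ^q^ t))
          ≡⟨ cong (tr q t) (expand a b (a ^q^ t) (b ^q^ t)) ⟩
        tr q t ((b * b ^q^ t + a * a ^q^ t) + (a * b ^q^ t + a ^q^ t * b))
          ≡⟨ tr-homo-+ t _ _ ⟩
        tr q t (b * b ^q^ t + a * a ^q^ t) + tr q t (a * b ^q^ t + a ^q^ t * b)
          ≡⟨ cong₂ _+_ (tr-homo-+ t _ _) (tr-cross-term 1+r≤t) ⟩
        tr q t (b * b ^q^ t) + tr q t (a * a ^q^ t) + 0#
          ≡⟨ +-identityʳ _ ⟩
        tr q t (b * b ^q^ t) + tr q t (a * a ^q^ t)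
          ≡⟨ cong₂ _+_ (tr-diagonal r) (tr-partial-norm r (ℕ.<⇒≤ 1+r≤t)) ⟩
        ε + r × ε
          ∎
        where
        a b : Carrier
        a = tr q r θ
        b = θ ^q^ r

        expand : ∀ a b c d → (a + b) * (c + d) ≡ (b * d + a * c) + (a * d + c * b)
        expand = solve 4 (λ a b c d → ((a ⊕ b) ⊗ (c ⊕ d)) ⊜ ((b ⊗ d ⊕ a ⊗ c) ⊕ (a ⊗ d ⊕ c ⊗ b))) refl

      y^q^t≡y+1 : y ^q^ t ≡ y + 1#
      y^q^t≡y+1 = sym (x+y≡0⇒x≡y (begin
        (y + 1#) + y ^q^ t   ≡⟨ solve 3 (λ a b c → ((a ⊕ b) ⊕ c) ⊜ ((a ⊕ c) ⊕ b)) refl y 1# (y ^q^ t) ⟩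
        (y + y ^q^ t) + 1#   ≡⟨ cong (_+ 1#) y+y^q^t≡1 ⟩
        1# + 1#              ≡⟨ 1+1≡0 ⟩
        0#                   ∎))

      w : Carrier
      w = tr q t y

      ε≡w^2+w : ε ≡ w ^ 2 + w
      ε≡w^2+w = begin
        ε                          ≡⟨ +-identityʳ ε ⟨
        ε + 0#                     ≡⟨ cong (ε +_) (even×x≡0 m ε) ⟨
        t × ε                      ≡⟨ tr-partial-norm t ℕ.≤-refl ⟨
        tr q t (y * y ^q^ t)       ≡⟨ cong (λ u → tr q t (y * u)) y^q^t≡y+1 ⟩
        tr q t (y * (y + 1#))
          ≡⟨ cong (tr q t) (trans (distribˡ y y 1#) (cong₂ _+_ (sym (x^2≡x*x y)) (*-identityʳ y))) ⟩
        tr q t (y ^ 2 + y)         ≡⟨ tr-homo-+ t (y ^ 2) y ⟩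
        tr q t (y ^ 2) + w         ≡⟨ cong (_+ w) (tr-^ 2 additive-2 t y) ⟩
        w ^ 2 + w                  ∎

      Tr₂ε≡1 : Tr F 2 k (Tr F q t (pow F θ (q ℕ.^ t ℕ.+ 1))) ≡ 1#
      Tr₂ε≡1 = begin
        Tr F 2 k (Tr F q t (pow F θ (q ℕ.^ t ℕ.+ 1)))  ≡⟨ Tr≡tr 2 k _ ⟩
        tr 2 k (Tr F q t (pow F θ (q ℕ.^ t ℕ.+ 1)))
          ≡⟨ cong (tr 2 k) (trans (Tr≡tr q t _) (cong (tr q t) (pow≡^ θ (q ℕ.^ t ℕ.+ 1)))) ⟩
        tr 2 k ε                ≡⟨ cong (tr 2 k) ε≡w^2+w ⟩
        tr 2 k (w ^ 2 + w)      ≡⟨ tr-telescope 2 additive-2 k w ⟩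
        w ^ q + w               ≡⟨ tr^Q+tr q q-add t y ⟩
        y ^q^ t + y             ≡⟨ +-comm _ y ⟩
        y + y ^q^ t             ≡⟨ y+y^q^t≡1 ⟩
        1#                      ∎

open import Data.Nat using (_+_; _*_; _^_; _≤_; s≤s; z≤n)
open import Data.Nat.Solver using (module +-*-Solver)

4m+2≡t+t : ∀ m → 4 * m + 2 ≡ suc (2 * m) + suc (2 * m)
4m+2≡t+t = solve 1 (λ m → con 4 :* m :+ con 2 := (con 1 :+ con 2 :* m) :+ (con 1 :+ con 2 :* m)) refl
  where open +-*-Solver

lemma5 : (F : Field) (k m : ℕ) → 1 ≤ k →
         Field.Carrier F ⤖ Fin ((2 ^ k) ^ (4 * m + 2)) →
         (θ : Field.Carrier F) →
         IsNormalBasis F (2 ^ k) (4 * m + 2) θ →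
         IsSelfDual F (2 ^ k) (4 * m + 2) θ →
         Tr F 2 k (Tr F (2 ^ k) (2 * m + 1) (pow F θ ((2 ^ k) ^ (2 * m + 1) + 1))) ≡ Field.1# F
lemma5 F (suc k) m (s≤s z≤n) F⤖Fin θ _ isSelfDual =
  subst (λ t → Tr F 2 (suc k) (Tr F q t (pow F θ (q ^ t + 1))) ≡ Field.1# F)
        (ℕ.+-comm 1 (2 * m))
        (SelfDualNormalBasis.Tr₂ε≡1 F 1+1≡0 _≟_ (suc k) m θ
          (subst (λ n → IsSelfDual F q n θ) (4m+2≡t+t m) isSelfDual))
  where
  q b : ℕ
  q = 2 ^ suc k
  b = 2 ^ k * q ^ (4 * m + 1)

  order≡2b : q ^ (4 * m + 2) ≡ 2 * b
  order≡2b = trans (cong (q ^_) (ℕ.+-suc (4 * m) 1)) (ℕ.*-assoc 2 (2 ^ k) (q ^ (4 * m + 1)))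

  1+1≡0 : Field._+_ F (Field.1# F) (Field.1# F) ≡ Field.0# F
  1+1≡0 = evenOrder⇒1+1≡0 F {b} (subst (λ N → Field.Carrier F ⤖ Fin N) order≡2b F⤖Fin)

  _≟_ : DecidableEquality (Field.Carrier F)
  _≟_ = inj⇒≟ (Bijection.injection F⤖Fin)
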